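{- Let $(G,\sigma)$ be a $g$-wide signed graph and let $x,y$ be two vertices of $G$ that lie on a common negative cycle of length $g$, with $ad_{(G,\sigma)}(x,y)=p$. Write $E={\rm EDC}(G,\sigma)$. (1) If $p>0$, then $ad_E(x^+,y^+)=ad_E(x^-,y^-)=p$; moreover, if $d_G(x,y)=\lfloor g/2\rfloor$ then $ad_E(x^+,y^-)=ad_E(x^-,y^+)=g-p=\lceil g/2\rceil$, and otherwise $ad_E(x^+,y^-)=ad_E(x^-,y^+)=-p-1$. (2) If $p<0$, then $ad_E(x^+,y^-)=ad_E(x^-,y^+)=-p$; moreover, if $d_G(x,y)=\lfloor g/2\rfloor$ then $ad_E(x^+,y^+)=ad_E(x^-,y^-)=g+p=\lceil g/2\rceil$, and otherwise $ad_E(x^+,y^+)=ad_E(x^-,y^-)=p-1$.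
   Context: A signed graph $(G,\sigma)$ is a graph with a signature $\sigma:E(G)\to\{+,-\}$. The sign of a walk is the product of the signs of its edges (with multiplicity). A closed walk is of type $ij\in\mathbb{Z}_2^2$ with $i=0$ if positive, $i=1$ if negative, and $j$ the parity of its length; $g_{ij}(G,\sigma)$ is the minimum length of a closed walk of type $ij$ ($\infty$ if none). $C_{ -g}$ is a cycle of length $g$ with an odd number of negative edges, and $(G,\sigma)$ is $g$-wide if $g_{ij}(G,\sigma)\ge g_{ij}(C_{ -g})$ for all $ij\in\mathbb{Z}_2^2$. The algebraic distance $ad_{(G,\sigma)}(u,v)$ equals $d_G(u,v)$ if there is a positive $u$–$v$ path of length $d_G(u,v)$, and $-d_G(u,v)$ otherwise ($d_G$ is the usual graph distance). The Extended Double Cover ${\rm EDC}(G,\sigma)$ is the signed graph on vertex set $\{v^+,v^-:v\in V(G)\}$ where: for each vertex $x$, $x^+x^-$ is a negative edge; for each positive edge $uv$, $u^+v^+$ and $u^-v^-$ are positive edges; for each negative edge $uv$, $u^+v^-$ and $u^-v^+$ are positive edges; there are no other edges. -}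

module Defs where

open import Data.Nat using (ℕ; zero; suc; _+_; _≤_; _∸_; _≡ᵇ_)
open import Data.Bool using (Bool; true; false; if_then_else_; _∧_; _∨_)
open import Data.Maybe using (Maybe; just; nothing)
open import Data.Fin using (Fin; toℕ)
open import Data.Product using (_×_; _,_; Σ; ∃; ∃-syntax)
open import Data.Sum using (_⊎_)
open import Data.List using (List; []; _∷_)
open import Data.List.Relation.Unary.Unique.Propositional using (Unique)
open import Data.List.Membership.Propositional using (_∈_)
open import Data.Integer using (ℤ; +_; -_)
open import Relation.Binary.PropositionalEquality using (_≡_)
open import Relation.Binary.Definitions using (DecidableEquality)
open import Relation.Nullary using (¬_; yes; no)

data Sign : Set where
  pos neg : Sign

_·_ : Sign → Sign → Sign
pos · s = s
neg · pos = neg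
neg · neg = pos

SGraph : Set → Set
SGraph V = V → V → Maybe Sign

record Simple {V : Set} (G : SGraph V) : Set where
  field
    symm    : ∀ u v → G u v ≡ G v u
    loopless : ∀ v → G v v ≡ nothing

data Walk {V : Set} (G : SGraph V) : V → V → Set where
  nil  : ∀ {u} → Walk G u u
  cons : ∀ {u v} (w : V) (s : Sign) → G u w ≡ just s → Walk G w v → Walk G u v

module _ {V : Set} {G : SGraph V} where

  len : ∀ {u v} → Walk G u v → ℕ
  len nil = 0
  len (cons _ _ _ W) = suc (len W)

  sign : ∀ {u v} → Walk G u v → Sign
  sign nil = pos
  sign (cons _ s _ W) = s · sign W

  verts : ∀ {u v} → Walk G u v → List V
  verts {u} nil = u ∷ []
  verts {u} (cons _ _ _ W) = u ∷ verts W

  -- vertices visited, final vertex omitted (for a closed walk: each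
  -- position of the cycle listed once)
  inner : ∀ {u v} → Walk G u v → List V
  inner nil = []
  inner {u} (cons _ _ _ W) = u ∷ inner W

IsPath : {V : Set} {G : SGraph V} {u v : V} → Walk G u v → Set
IsPath W = Unique (verts W)

IsCycle : {V : Set} {G : SGraph V} {u : V} → Walk G u u → Set
IsCycle W = 3 ≤ len W × Unique (inner W)

parity : ℕ → Bool
parity zero = false
parity (suc n) with parity n
... | true = false
... | false = true

-- The negative cycle C_{-g} on Fin g: edges {i,i+1} (i+1 < g) positive,
-- and the closing edge {0, g-1} negative.

C- : (g : ℕ) → SGraph (Fin g)
C- g i j =
  if ((toℕ i ≡ᵇ 0) ∧ (toℕ j ≡ᵇ (g ∸ 1))) ∨ ((toℕ j ≡ᵇ 0) ∧ (toℕ i ≡ᵇ (g ∸ 1)))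
  then just neg
  else (if (suc (toℕ i) ≡ᵇ toℕ j) ∨ (suc (toℕ j) ≡ᵇ toℕ i)
        then just pos
        else nothing)

-- g-wide: g_ij(G) ≥ g_ij(C_{-g}) for every type ij, i.e. every closed
-- walk of G of a given type (sign, parity of length) is at least as long as
-- some closed walk of C_{-g} of the same type.
Wide : {V : Set} → ℕ → SGraph V → Set
Wide {V} g G =
  ∀ (u : V) (W : Walk G u u) →
    ∃[ c ] Σ (Walk (C- g) c c) λ W' →
      sign W' ≡ sign W × parity (len W') ≡ parity (len W) × len W' ≤ len W

IsDist : {V : Set} → SGraph V → V → V → ℕ → Set
IsDist G u v d = (Σ (Walk G u v) λ W → len W ≡ d) × (∀ (W : Walk G u v) → d ≤ len W)

PosPathOfLen : {V : Set} → SGraph V → V → V → ℕ → Set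
PosPathOfLen G u v d = Σ (Walk G u v) λ W → IsPath W × sign W ≡ pos × len W ≡ d

AD : {V : Set} → SGraph V → V → V → ℤ → Set
AD G u v z = ∃[ d ] IsDist G u v d ×
  ((PosPathOfLen G u v d × z ≡ + d) ⊎ (¬ PosPathOfLen G u v d × z ≡ - (+ d)))

OnCommonNegCycle : {V : Set} → SGraph V → ℕ → V → V → Set
OnCommonNegCycle G g x y =
  ∃[ c ] Σ (Walk G c c) λ W →
    IsCycle W × len W ≡ g × sign W ≡ neg × x ∈ inner W × y ∈ inner W

-- Extended double cover: vertex (v , pos) is v⁺, (v , neg) is v⁻.

sameSign : Sign → Sign → Bool
sameSign pos pos = true
sameSign neg neg = true
sameSign _ _ = false

EDC : {V : Set} → DecidableEquality V → SGraph V → SGraph (V × Sign)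
EDC _≟_ G (u , a) (v , b) with u ≟ v
... | yes _ = if sameSign a b then nothing else just neg
... | no _ with G u v
...   | nothing = nothing
...   | just s = if sameSign (a · b) s then just pos else nothing

{-# OPTIONS --safe #-}
module Submission where

-- Let P be a shortest x–y path, σ its sign and d its length. Forgetting layers, a walk of the
-- cover is a walk of G interrupted by t vertical edges: it is t edges longer, has sign (−)^t,
-- and ends in the layer shifted by the sign of its projection times (−)^t; conversely walks of G
-- lift to positive walks of the same length. As in C_{-g} (where this is a winding-number count), g-wideness makes
-- every negative closed walk at least g long, so x–y walks of sign −σ have length at least g − d,
-- and the negative g-cycle through x and y supplies one of exactly that length; hence 2d ≤ g.
-- Between x^a and y^{σa} the distance is thus d, realised positively by the lift of P. A walk
-- from x^a to y^{−σa} is either horizontal, of length at least g − d, or has length at least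
-- d + 1, with equality only if it is negative. So its distance is g − d = ⌈g/2⌉ when
-- d = ⌊g/2⌋, and otherwise d + 1, attained by negative walks only.

open import Defs
open import Level using (0ℓ)
open import Algebra.Bundles using (CommutativeSemigroup)
import Algebra.Properties.CommutativeSemigroup as CommutativeSemigroupProperties
open import Data.Bool using (true; false; T; if_then_else_; _∧_)
open import Data.Bool.Properties using (T-∧; T-∨)
open import Data.Empty using (⊥-elim)
open import Data.Fin using (Fin; toℕ)
open import Data.Integer as ℤ using (ℤ; +_; -[1+_]; -_; ∣_∣; +<+)
open import Data.Integer.Properties using (∣i+j∣≤∣i∣+∣j∣; ∣i*j∣≡∣i∣*∣j∣; neg-involutive; neg-≤-pos; <⇒≱)
open import Data.Integer.Tactic.RingSolver using (solve-∀)
open import Data.List as List using ([]; _∷_)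
open import Data.List.Membership.Propositional using (_∈_)
open import Data.List.Relation.Unary.All using ([])
open import Data.List.Relation.Unary.All.Properties using (¬Any⇒All¬)
open import Data.List.Relation.Unary.AllPairs using ([]; _∷_)
open import Data.List.Relation.Unary.Any using (here; there)
open import Data.List.Relation.Unary.Any.Properties using () renaming (++-comm to ∈-++-comm)
open import Data.Maybe using (just; nothing)
open import Data.Nat using (ℕ; zero; suc; ⌊_/2⌋; ⌈_/2⌉)
open import Data.Product using (_×_; _,_; Σ; ∃-syntax; uncurry)
open import Data.Sum using (_⊎_; inj₁; inj₂; [_,_]′)
open import Function using (_∘_)
open import Function.Bundles using (Equivalence)
open import Relation.Binary.Definitions using (DecidableEquality)
open import Relation.Binary.PropositionalEquality
open import Relation.Binary.PropositionalEquality.Algebra using (isMagma)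
open import Relation.Nullary using (¬_; yes; no)

-- ℕ arithmetic is opened only inside this block: the statement below uses the operators of ℤ.
module _ where
  open import Data.Nat using (_+_; _*_; _≤_; _∸_; _≡ᵇ_; z≤n; s≤s; _≤?_)
  open import Data.Nat.Properties
    using ( ≡ᵇ⇒≡; ≤-reflexive; ≤-trans; ≤-antisym; ≤-pred; <-irrefl; ≰⇒>; n≤1+n
          ; m≤m+n; m≤n+m; +-comm; +-suc; +-identityʳ; +-mono-≤; +-monoʳ-≤; +-cancelʳ-≤; +-cancelʳ-≡
          ; m≤n⇒m<n∨m≡n; ⌊n/2⌋+⌈n/2⌉≡n; n≡⌊n+n/2⌋; n≡⌈n+n/2⌉; module ≤-Reasoning)

  ·-comm : ∀ a b → a · b ≡ b · a
  ·-comm pos pos = refl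
  ·-comm pos neg = refl
  ·-comm neg pos = refl
  ·-comm neg neg = refl

  ·-assoc : ∀ a b c → (a · b) · c ≡ a · (b · c)
  ·-assoc pos b c = refl
  ·-assoc neg pos c = refl
  ·-assoc neg neg pos = refl
  ·-assoc neg neg neg = refl

  ·-identityʳ : ∀ a → a · pos ≡ a
  ·-identityʳ pos = refl
  ·-identityʳ neg = refl

  ·-involutiveˡ : ∀ a b → a · (a · b) ≡ b
  ·-involutiveˡ pos b = refl
  ·-involutiveˡ neg pos = refl
  ·-involutiveˡ neg neg = refl

  ·-involutiveʳ : ∀ a b → (b · a) · a ≡ b
  ·-involutiveʳ pos b = trans (·-identityʳ (b · pos)) (·-identityʳ b)
  ·-involutiveʳ neg pos = refl
  ·-involutiveʳ neg neg = refl

  ·-cancelʳ : ∀ {a b} c → a · c ≡ b · c → a ≡ b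
  ·-cancelʳ {a} {b} c eq = trans (sym (·-involutiveʳ c a)) (trans (cong (_· c) eq) (·-involutiveʳ c b))

  a·b≡c⇒b≡c·a : ∀ {a b c} → a · b ≡ c → b ≡ c · a
  a·b≡c⇒b≡c·a {a} {b} {c} eq = trans (sym (·-involutiveˡ a b)) (trans (cong (a ·_) eq) (·-comm a c))

  sign-dichotomy : ∀ a b → a ≡ b ⊎ a ≡ neg · b
  sign-dichotomy pos pos = inj₁ refl
  sign-dichotomy pos neg = inj₂ refl
  sign-dichotomy neg pos = inj₂ refl
  sign-dichotomy neg neg = inj₁ refl

  ·-commutativeSemigroup : CommutativeSemigroup 0ℓ 0ℓ
  ·-commutativeSemigroup = record
    { Carrier = Sign
    ; _≈_ = _≡_
    ; _∙_ = _·_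
    ; isCommutativeSemigroup = record
      { isSemigroup = record { isMagma = isMagma _·_ ; assoc = ·-assoc }
      ; comm = ·-comm
      }
    }

  open CommutativeSemigroupProperties ·-commutativeSemigroup
    using (x∙yz≈y∙xz; x∙yz≈yx∙z; xy∙z≈y∙xz)

  neg^ : ℕ → Sign
  neg^ zero = pos
  neg^ (suc t) = neg · neg^ t

  neg^n≡neg⇒m≤n*m : ∀ n {m} → neg^ n ≡ neg → m ≤ n * m
  neg^n≡neg⇒m≤n*m (suc n) {m} _ = m≤m+n m (n * m)

  sameSign-refl : ∀ a → sameSign a a ≡ true
  sameSign-refl pos = refl
  sameSign-refl neg = refl

  sameSign-neg : ∀ a → sameSign a (neg · a) ≡ false
  sameSign-neg pos = refl
  sameSign-neg neg = refl

  sameSign-sound : ∀ {a b} → sameSign a b ≡ true → a ≡ b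
  sameSign-sound {pos} {pos} _ = refl
  sameSign-sound {neg} {neg} _ = refl

  sameSign-false : ∀ {a b} → sameSign a b ≡ false → b ≡ neg · a
  sameSign-false {pos} {neg} _ = refl
  sameSign-false {neg} {pos} _ = refl

  module _ {V : Set} {G : SGraph V} where

    infixr 5 _++_
    _++_ : ∀ {u v w} → Walk G u v → Walk G v w → Walk G u w
    nil ++ B = B
    cons w s e A ++ B = cons w s e (A ++ B)

    len-++ : ∀ {u v w} (A : Walk G u v) (B : Walk G v w) → len (A ++ B) ≡ len A + len B
    len-++ nil B = refl
    len-++ (cons w s e A) B = cong suc (len-++ A B)

    sign-++ : ∀ {u v w} (A : Walk G u v) (B : Walk G v w) → sign (A ++ B) ≡ sign A · sign B
    sign-++ nil B = refl
    sign-++ (cons w s e A) B = trans (cong (s ·_) (sign-++ A B)) (sym (·-assoc s (sign A) (sign B)))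

    inner-++ : ∀ {u v w} (A : Walk G u v) (B : Walk G v w) → inner (A ++ B) ≡ inner A List.++ inner B
    inner-++ nil B = refl
    inner-++ {u} (cons w s e A) B = cong (u ∷_) (inner-++ A B)

    inner⊆verts : ∀ {u v x} (W : Walk G u v) → x ∈ inner W → x ∈ verts W
    inner⊆verts (cons w s e W) (here x≡u) = here x≡u
    inner⊆verts (cons w s e W) (there x∈W) = there (inner⊆verts W x∈W)

    splitAt : ∀ {u v x} (W : Walk G u v) → x ∈ verts W →
      Σ (Walk G u x) λ A → Σ (Walk G x v) λ B → A ++ B ≡ W
    splitAt nil (here refl) = nil , nil , refl
    splitAt (cons w s e W) (here refl) = nil , cons w s e W , refl
    splitAt (cons w s e W) (there x∈W) with splitAt W x∈W
    ... | A , B , A++B≡W = cons w s e A , B , cong (cons w s e) A++B≡W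

    shortest⇒path : ∀ {u v} (W : Walk G u v) → (∀ (W′ : Walk G u v) → len W ≤ len W′) → IsPath W
    shortest⇒path nil _ = [] ∷ []
    shortest⇒path {u} (cons w s e W) shortest =
      ¬Any⇒All¬ (verts W) revisits ∷ shortest⇒path W (λ W′ → ≤-pred (shortest (cons w s e W′)))
      where
      open ≤-Reasoning
      revisits : ¬ (u ∈ verts W)
      revisits u∈W with splitAt W u∈W
      ... | A , B , A++B≡W = <-irrefl refl (begin-strict
        len W         <⟨ shortest B ⟩
        len B         ≤⟨ m≤n+m (len B) (len A) ⟩
        len A + len B ≡⟨ sym (len-++ A B) ⟩
        len (A ++ B)  ≡⟨ cong len A++B≡W ⟩
        len W         ∎)

    len-++-comm : ∀ {u v} (A : Walk G u v) (B : Walk G v u) → len (A ++ B) ≡ len (B ++ A)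
    len-++-comm A B = trans (len-++ A B) (trans (+-comm (len A) (len B)) (sym (len-++ B A)))

    sign-++-comm : ∀ {u v} (A : Walk G u v) (B : Walk G v u) → sign (A ++ B) ≡ sign (B ++ A)
    sign-++-comm A B = trans (sign-++ A B) (trans (·-comm (sign A) (sign B)) (sym (sign-++ B A)))

    IsDist-unique : ∀ {u v m n} → IsDist G u v m → IsDist G u v n → m ≡ n
    IsDist-unique ((W , refl) , shortest) ((W′ , refl) , shortest′) = ≤-antisym (shortest W′) (shortest′ W)

    ¬PosPathOfLen⇒negative : ∀ {u v} (W : Walk G u v) → (∀ (W′ : Walk G u v) → len W ≤ len W′) →
      ¬ PosPathOfLen G u v (len W) → sign W ≡ neg
    ¬PosPathOfLen⇒negative W shortest no-positive-path with sign W in sign-W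
    ... | pos = ⊥-elim (no-positive-path (W , shortest⇒path W shortest , sign-W , refl))
    ... | neg = refl

    AD-positive : ∀ {u v ℓ} (W : Walk G u v) → len W ≡ ℓ → (∀ (W′ : Walk G u v) → ℓ ≤ len W′) → sign W ≡ pos →
      AD G u v (+ ℓ)
    AD-positive W refl shortest positive =
      len W , ((W , refl) , shortest) , inj₁ ((W , shortest⇒path W shortest , positive , refl) , refl)

    AD-negative : ∀ {u v ℓ} (W : Walk G u v) → len W ≡ ℓ → (∀ (W′ : Walk G u v) → ℓ ≤ len W′) →
      (∀ (W′ : Walk G u v) → sign W′ ≡ pos → len W′ ≢ ℓ) → AD G u v (- (+ ℓ))
    AD-negative W refl shortest no-positive =
      len W , ((W , refl) , shortest) , inj₂ ((λ (W′ , _ , positive , ℓ≡) → no-positive W′ positive ℓ≡) , refl)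

    module _ (symm : ∀ u v → G u v ≡ G v u) where

      reverse : ∀ {u v} → Walk G u v → Walk G v u
      reverse nil = nil
      reverse {u} (cons w s e W) = reverse W ++ cons u s (trans (symm w u) e) nil

      len-reverse : ∀ {u v} (W : Walk G u v) → len (reverse W) ≡ len W
      len-reverse nil = refl
      len-reverse (cons w s e W) =
        trans (len-++ (reverse W) _) (trans (+-comm (len (reverse W)) 1) (cong suc (len-reverse W)))

      sign-reverse : ∀ {u v} (W : Walk G u v) → sign (reverse W) ≡ sign W
      sign-reverse nil = refl
      sign-reverse (cons w s e W) =
        trans (sign-++ (reverse W) _) (trans (cong₂ _·_ (sign-reverse W) (·-identityʳ s)) (·-comm (sign W) s))

      closed-walk-arcs : ∀ {c x y} (C : Walk G c c) → x ∈ inner C → y ∈ inner C →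
        Σ (Walk G x y) λ A → Σ (Walk G x y) λ B → len A + len B ≡ len C × sign A · sign B ≡ sign C
      closed-walk-arcs C x∈C y∈C with splitAt C (inner⊆verts C x∈C)
      ... | C₁ , C₂ , refl with splitAt (C₂ ++ C₁) (inner⊆verts (C₂ ++ C₁) y∈rotation)
        where
        y∈rotation = subst (_ ∈_) (sym (inner-++ C₂ C₁))
                       (∈-++-comm (inner C₁) (inner C₂) (subst (_ ∈_) (inner-++ C₁ C₂) y∈C))
      ... | A , B , A++B≡C₂++C₁ = A , reverse B ,
        trans (cong (_+_ (len A)) (len-reverse B))
          (trans (sym (len-++ A B)) (trans (cong len A++B≡C₂++C₁) (len-++-comm C₂ C₁))) ,
        trans (cong (sign A ·_) (sign-reverse B))
          (trans (sym (sign-++ A B)) (trans (cong sign A++B≡C₂++C₁) (sign-++-comm C₂ C₁)))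

      negative-cycle-arcs : ∀ {g x y} → OnCommonNegCycle G g x y →
        Σ (Walk G x y) λ A → Σ (Walk G x y) λ B → len A + len B ≡ g × sign A · sign B ≡ neg
      negative-cycle-arcs (_ , C , _ , len-C , sign-C , x∈C , y∈C) with closed-walk-arcs C x∈C y∈C
      ... | A , B , len-AB , sign-AB = A , B , trans len-AB len-C , trans sign-AB sign-C

  data CycleEdge (g i j : ℕ) : Sign → Set where
    forward      : suc i ≡ j → CycleEdge g i j pos
    backward     : suc j ≡ i → CycleEdge g i j pos
    closing-down : i ≡ 0 → j ≡ g ∸ 1 → CycleEdge g i j neg
    closing-up   : j ≡ 0 → i ≡ g ∸ 1 → CycleEdge g i j neg

  if-neg-else-if-pos : ∀ b c {s} → (if b then just neg else (if c then just pos else nothing)) ≡ just s →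
    T b × s ≡ neg ⊎ T c × s ≡ pos
  if-neg-else-if-pos true _ refl = inj₁ (_ , refl)
  if-neg-else-if-pos false true refl = inj₂ (_ , refl)

  ≡ᵇ-∧-sound : ∀ {a b c d} → T ((a ≡ᵇ b) ∧ (c ≡ᵇ d)) → a ≡ b × c ≡ d
  ≡ᵇ-∧-sound {a} {b} {c} {d} t with Equivalence.to T-∧ t
  ... | a≡ᵇb , c≡ᵇd = ≡ᵇ⇒≡ a b a≡ᵇb , ≡ᵇ⇒≡ c d c≡ᵇd

  C-edge : ∀ g {i j : Fin g} {s} → C- g i j ≡ just s → CycleEdge g (toℕ i) (toℕ j) s
  C-edge g {i} {j} e with if-neg-else-if-pos _ _ e
  ... | inj₁ (closing , s≡neg) = subst (CycleEdge g (toℕ i) (toℕ j)) (sym s≡neg)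
    ([ uncurry closing-down ∘ ≡ᵇ-∧-sound , uncurry closing-up ∘ ≡ᵇ-∧-sound ]′ (Equivalence.to T-∨ closing))
  ... | inj₂ (adjacent , s≡pos) = subst (CycleEdge g (toℕ i) (toℕ j)) (sym s≡pos)
    ([ forward ∘ ≡ᵇ⇒≡ _ _ , backward ∘ ≡ᵇ⇒≡ _ _ ]′ (Equivalence.to T-∨ adjacent))

  neg^∣suc∣ : ∀ k → neg^ ∣ ℤ.suc k ∣ ≡ neg · neg^ ∣ k ∣
  neg^∣suc∣ (+ n) = refl
  neg^∣suc∣ -[1+ zero ] = refl
  neg^∣suc∣ -[1+ suc n ] = sym (·-involutiveˡ neg (neg^ (suc n)))

  neg^∣pred∣ : ∀ k → neg^ ∣ ℤ.pred k ∣ ≡ neg · neg^ ∣ k ∣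
  neg^∣pred∣ (+ zero) = refl
  neg^∣pred∣ (+ suc n) = sym (·-involutiveˡ neg (neg^ n))
  neg^∣pred∣ -[1+ n ] = refl

  ∣i+j∣≤1+∣i∣ : ∀ i j → ∣ j ∣ ≡ 1 → ∣ i ℤ.+ j ∣ ≤ suc ∣ i ∣
  ∣i+j∣≤1+∣i∣ i j ∣j∣≡1 =
    ≤-trans (∣i+j∣≤∣i∣+∣j∣ i j) (≤-reflexive (trans (cong (_+_ ∣ i ∣) ∣j∣≡1) (+-comm ∣ i ∣ 1)))

  unit-step : ∀ {D′ L} D δ → D′ ≡ D ℤ.+ δ → ∣ δ ∣ ≡ 1 → ∣ D ∣ ≤ L → ∣ D′ ∣ ≤ suc L
  unit-step D δ refl ∣δ∣≡1 bound = ≤-trans (∣i+j∣≤1+∣i∣ D δ ∣δ∣≡1) (s≤s bound)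

  -- Unwinding C_{-g} (g = suc h) onto ℤ: a walk from u to v of length L ends within distance L of
  -- the copy v + k g of v, where k is the net number of times it crosses the closing edge, and
  -- its sign is (−)^k.
  module _ (h : ℕ) where

    displacement : ℤ → Fin (suc h) → Fin (suc h) → ℤ
    displacement k u v = + toℕ v ℤ.+ k ℤ.* + suc h ℤ.- + toℕ u

    forward-displacement : ∀ k {u w v} → suc (toℕ u) ≡ toℕ w →
      displacement k u v ≡ displacement k w v ℤ.+ + 1
    forward-displacement k {u} {w} {v} u+1≡w rewrite sym u+1≡w =
      identity (+ toℕ v ℤ.+ k ℤ.* + suc h) (+ toℕ u)
      where
      identity : ∀ A u → A ℤ.- u ≡ (A ℤ.- (+ 1 ℤ.+ u)) ℤ.+ + 1
      identity = solve-∀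

    backward-displacement : ∀ k {u w v} → suc (toℕ w) ≡ toℕ u →
      displacement k u v ≡ displacement k w v ℤ.+ - (+ 1)
    backward-displacement k {u} {w} {v} w+1≡u rewrite sym w+1≡u =
      identity (+ toℕ v ℤ.+ k ℤ.* + suc h) (+ toℕ w)
      where
      identity : ∀ A w → A ℤ.- (+ 1 ℤ.+ w) ≡ (A ℤ.- w) ℤ.+ - (+ 1)
      identity = solve-∀

    closing-down-displacement : ∀ k {u w v} → toℕ u ≡ 0 → toℕ w ≡ h →
      displacement (ℤ.pred k) u v ≡ displacement k w v ℤ.+ - (+ 1)
    closing-down-displacement k {u} {w} {v} u≡0 w≡h rewrite u≡0 | w≡h =
      identity (+ toℕ v) k (+ h)
      where
      identity : ∀ v k h → v ℤ.+ (- (+ 1) ℤ.+ k) ℤ.* (+ 1 ℤ.+ h) ℤ.- + 0 ≡ (v ℤ.+ k ℤ.* (+ 1 ℤ.+ h) ℤ.- h) ℤ.+ - (+ 1)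
      identity = solve-∀

    closing-up-displacement : ∀ k {u w v} → toℕ w ≡ 0 → toℕ u ≡ h →
      displacement (ℤ.suc k) u v ≡ displacement k w v ℤ.+ + 1
    closing-up-displacement k {u} {w} {v} w≡0 u≡h rewrite w≡0 | u≡h =
      identity (+ toℕ v) k (+ h)
      where
      identity : ∀ v k h → v ℤ.+ (+ 1 ℤ.+ k) ℤ.* (+ 1 ℤ.+ h) ℤ.- h ≡ (v ℤ.+ k ℤ.* (+ 1 ℤ.+ h) ℤ.- + 0) ℤ.+ + 1
      identity = solve-∀

    winding : ∀ {u v} (W : Walk (C- (suc h)) u v) →
      ∃[ k ] ∣ displacement k u v ∣ ≤ len W × sign W ≡ neg^ ∣ k ∣
    winding {u} nil = + 0 , ≤-reflexive (cong ∣_∣ (identity (+ toℕ u))) , refl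
      where
      identity : ∀ u → u ℤ.+ + 0 ℤ.- u ≡ + 0
      identity = solve-∀
    winding {u} {v} (cons w s e W) with winding W | C-edge (suc h) {u} {w} e
    ... | k , bound , sign-W | forward u+1≡w =
      k , unit-step (displacement k w v) (+ 1) (forward-displacement k u+1≡w) refl bound , sign-W
    ... | k , bound , sign-W | backward w+1≡u =
      k , unit-step (displacement k w v) (- (+ 1)) (backward-displacement k w+1≡u) refl bound , sign-W
    ... | k , bound , sign-W | closing-down u≡0 w≡h =
      ℤ.pred k , unit-step (displacement k w v) (- (+ 1)) (closing-down-displacement k u≡0 w≡h) refl bound ,
      trans (cong (neg ·_) sign-W) (sym (neg^∣pred∣ k))
    ... | k , bound , sign-W | closing-up w≡0 u≡h =
      ℤ.suc k , unit-step (displacement k w v) (+ 1) (closing-up-displacement k w≡0 u≡h) refl bound ,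
      trans (cong (neg ·_) sign-W) (sym (neg^∣suc∣ k))

  C-‿negative-closed-walk-length : ∀ g {c : Fin g} (W : Walk (C- g) c c) → sign W ≡ neg → g ≤ len W
  C-‿negative-closed-walk-length (suc h) {c} W negative with winding h W
  ... | k , bound , sign-W = begin
    suc h                       ≤⟨ neg^n≡neg⇒m≤n*m ∣ k ∣ (trans (sym sign-W) negative) ⟩
    ∣ k ∣ * suc h               ≡⟨ sym (∣i*j∣≡∣i∣*∣j∣ k (+ suc h)) ⟩
    ∣ k ℤ.* + suc h ∣           ≡⟨ cong ∣_∣ (sym (identity (+ toℕ c) (k ℤ.* + suc h))) ⟩
    ∣ displacement h k c c ∣    ≤⟨ bound ⟩
    len W                       ∎
    where
    open ≤-Reasoning
    identity : ∀ c K → c ℤ.+ K ℤ.- c ≡ K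
    identity = solve-∀

  Wide⇒negative-closed-walk-length : ∀ {V} {G : SGraph V} {g} → Wide g G →
    ∀ {u} (W : Walk G u u) → sign W ≡ neg → g ≤ len W
  Wide⇒negative-closed-walk-length {g = g} wide W negative with wide _ W
  ... | _ , W′ , sign-W′ , _ , W′≤W = ≤-trans (C-‿negative-closed-walk-length g W′ (trans sign-W′ negative)) W′≤W

  module ExtendedDoubleCover {V : Set} (_≟_ : DecidableEquality V) {G : SGraph V} where

    data EDCEdge : V × Sign → V × Sign → Sign → Set where
      vertical   : ∀ {u a} → EDCEdge (u , a) (u , neg · a) neg
      horizontal : ∀ {u w a s} → G u w ≡ just s → EDCEdge (u , a) (w , s · a) pos

    EDC-edge : ∀ {u a v b s} → EDC _≟_ G (u , a) (v , b) ≡ just s → EDCEdge (u , a) (v , b) s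
    EDC-edge {u} {a} {v} {b} e with u ≟ v
    ... | yes refl with sameSign a b in same | e
    ...   | false | refl = subst (λ c → EDCEdge (u , a) (u , c) neg) (sym (sameSign-false same)) vertical
    EDC-edge {u} {a} {v} {b} e | no _ with G u v in edge | e
    ... | just s′ | e′ with sameSign (a · b) s′ in same | e′
    ...   | true | refl =
      subst (λ c → EDCEdge (u , a) (v , c) pos) (sym (a·b≡c⇒b≡c·a (sameSign-sound same))) (horizontal edge)

    vertical-edge : ∀ u a → EDC _≟_ G (u , a) (u , neg · a) ≡ just neg
    vertical-edge u a with u ≟ u
    ... | yes _ rewrite sameSign-neg a = refl
    ... | no u≢u = ⊥-elim (u≢u refl)

    record Projection {u a v b} (W : Walk (EDC _≟_ G) (u , a) (v , b)) : Set where
      constructor projection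
      field
        base      : Walk G u v
        verticals : ℕ
        len-base  : len base + verticals ≡ len W
        sign-walk : sign W ≡ neg^ verticals
        layer     : b ≡ sign base · (neg^ verticals · a)

    project : ∀ {u a v b} (W : Walk (EDC _≟_ G) (u , a) (v , b)) → Projection W
    project nil = projection nil 0 refl refl refl
    project {a = a} (cons (w , c) s e W) with EDC-edge e | project W
    ... | vertical | projection base t len-base sign-W layer =
      projection base (suc t) (trans (+-suc (len base) t) (cong suc len-base)) (cong (neg ·_) sign-W)
        (trans layer (cong (sign base ·_) (x∙yz≈yx∙z (neg^ t) neg a)))
    ... | horizontal {s = s′} edge | projection base t len-base sign-W layer =
      projection (cons w s′ edge base) t (cong suc len-base) sign-W
        (trans layer (trans (cong (sign base ·_) (x∙yz≈y∙xz (neg^ t) s′ a))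
                            (x∙yz≈yx∙z (sign base) s′ (neg^ t · a))))

    module _ (loopless : ∀ v → G v v ≡ nothing) where

      horizontal-edge : ∀ {u w s} a → G u w ≡ just s → EDC _≟_ G (u , a) (w , s · a) ≡ just pos
      horizontal-edge {u} {w} {s} a e with u ≟ w
      ... | yes refl with trans (sym (loopless u)) e
      ...   | ()
      horizontal-edge {u} {w} {s} a e | no _
        rewrite e | ·-comm s a | ·-involutiveˡ a s | sameSign-refl s = refl

      lift : ∀ {u v} (W : Walk G u v) a {b} → b ≡ sign W · a → Walk (EDC _≟_ G) (u , a) (v , b)
      lift nil a refl = nil
      lift (cons w s e W) a eq =
        cons (w , s · a) pos (horizontal-edge a e) (lift W (s · a) (trans eq (xy∙z≈y∙xz s (sign W) a)))

      len-lift : ∀ {u v} (W : Walk G u v) a {b} (eq : b ≡ sign W · a) → len (lift W a eq) ≡ len W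
      len-lift nil a refl = refl
      len-lift (cons w s e W) a eq = cong suc (len-lift W (s · a) _)

      sign-lift : ∀ {u v} (W : Walk G u v) a {b} (eq : b ≡ sign W · a) → sign (lift W a eq) ≡ pos
      sign-lift nil a refl = refl
      sign-lift (cons w s e W) a eq = sign-lift W (s · a) _

  ⌈n/2⌉≤1+⌊n/2⌋ : ∀ n → ⌈ n /2⌉ ≤ suc ⌊ n /2⌋
  ⌈n/2⌉≤1+⌊n/2⌋ zero = z≤n
  ⌈n/2⌉≤1+⌊n/2⌋ (suc zero) = s≤s z≤n
  ⌈n/2⌉≤1+⌊n/2⌋ (suc (suc n)) = s≤s (⌈n/2⌉≤1+⌊n/2⌋ n)

  ⌊n/2⌋-unique : ∀ {d n} → d + d ≤ n → n ≤ suc (d + d) → d ≡ ⌊ n /2⌋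
  ⌊n/2⌋-unique {d} 2d≤n n≤1+2d with m≤n⇒m<n∨m≡n n≤1+2d
  ... | inj₁ n≤2d = trans (n≡⌊n+n/2⌋ d) (cong ⌊_/2⌋ (≤-antisym 2d≤n (≤-pred n≤2d)))
  ... | inj₂ refl = n≡⌈n+n/2⌉ d

  -m-1≡-[1+m] : ∀ m → - (+ m) ℤ.- + 1 ≡ - (+ suc m)
  -m-1≡-[1+m] zero = refl
  -m-1≡-[1+m] (suc m) = cong (λ n → -[1+ suc n ]) (+-identityʳ m)

  module ShortestPathOnNegativeCycle
    {V : Set} (_≟_ : DecidableEquality V) {G : SGraph V} (simple : Simple G)
    {g : ℕ} (wide : Wide g G) {x y : V} (cycle : OnCommonNegCycle G g x y)
    (P : Walk G x y) (shortest : ∀ (W : Walk G x y) → len P ≤ len W) {σ : Sign} (sign-P : sign P ≡ σ) where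

    open Simple simple
    open ExtendedDoubleCover _≟_ {G}

    E : SGraph (V × Sign)
    E = EDC _≟_ G

    d : ℕ
    d = len P

    antiparallel-length : (W : Walk G x y) → sign W ≡ neg · σ → g ≤ len W + d
    antiparallel-length W sign-W =
      subst (g ≤_) length (Wide⇒negative-closed-walk-length wide (W ++ reverse symm P) negative)
      where
      length : len (W ++ reverse symm P) ≡ len W + d
      length = trans (len-++ W _) (cong (_+_ (len W)) (len-reverse symm P))
      negative : sign (W ++ reverse symm P) ≡ neg
      negative = trans (sign-++ W _)
        (trans (cong₂ _·_ sign-W (trans (sign-reverse symm P) sign-P)) (·-involutiveʳ σ neg))

    2d≤g : d + d ≤ g
    2d≤g with negative-cycle-arcs symm cycle
    ... | A , B , len-AB , _ = subst (d + d ≤_) len-AB (+-mono-≤ (shortest A) (shortest B))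

    antiparallel-arc-length : (A B : Walk G x y) → len A + len B ≡ g → sign A ≡ neg · σ → len A + d ≡ g
    antiparallel-arc-length A B len-AB sign-A =
      ≤-antisym (subst (len A + d ≤_) len-AB (+-monoʳ-≤ (len A) (shortest B))) (antiparallel-length A sign-A)

    antiparallel-walk : Σ (Walk G x y) λ O → sign O ≡ neg · σ × len O + d ≡ g
    antiparallel-walk with negative-cycle-arcs symm cycle
    ... | A , B , len-AB , sign-AB with sign-dichotomy (sign A) σ
    ...   | inj₂ sign-A = A , sign-A , antiparallel-arc-length A B len-AB sign-A
    ...   | inj₁ sign-A = B , sign-B , antiparallel-arc-length B A (trans (+-comm (len B) (len A)) len-AB) sign-B
      where
      sign-B : sign B ≡ neg · σ
      sign-B = trans (a·b≡c⇒b≡c·a sign-AB) (cong (neg ·_) sign-A)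

    antipodal-distance : IsDist G x y ⌊ g /2⌋ → d ≡ ⌊ g /2⌋
    antipodal-distance = IsDist-unique ((P , refl) , shortest)

    non-antipodal-distance : ¬ IsDist G x y ⌊ g /2⌋ → suc (suc (d + d)) ≤ g
    non-antipodal-distance not-antipodal with g ≤? suc (d + d)
    ... | yes g≤1+2d = ⊥-elim (not-antipodal (subst (IsDist G x y) (⌊n/2⌋-unique 2d≤g g≤1+2d) ((P , refl) , shortest)))
    ... | no g≰1+2d = ≰⇒> g≰1+2d

    len-E-walk≥d : ∀ {a b} (W : Walk E (x , a) (y , b)) → d ≤ len W
    len-E-walk≥d W = ≤-trans (shortest base) (subst (len base ≤_) len-base (m≤m+n (len base) verticals))
      where open Projection (project W)

    -- Split by the number of vertical edges: none (then the projection has sign −σ), one (then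
    -- the walk is negative), or at least two.
    crossed-walk-length : ∀ {a} (W : Walk E (x , a) (y , neg · (σ · a))) →
      g ≤ len W + d ⊎ (sign W ≡ neg × suc d ≤ len W) ⊎ suc (suc d) ≤ len W
    crossed-walk-length {a} W with project W
    ... | projection base zero len-base _ layer =
      inj₁ (subst (λ n → g ≤ n + d) (trans (sym (+-identityʳ (len base))) len-base)
             (antiparallel-length base (·-cancelʳ a (trans (sym layer) (sym (·-assoc neg σ a))))))
    ... | projection base (suc zero) len-base sign-W _ =
      inj₂ (inj₁ (sign-W , subst (suc d ≤_) (trans (+-comm 1 (len base)) len-base) (s≤s (shortest base))))
    ... | projection base (suc (suc t)) len-base _ _ = inj₂ (inj₂ (begin
      2 + d                  ≤⟨ s≤s (s≤s (shortest base)) ⟩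
      2 + len base           ≡⟨ +-comm 2 (len base) ⟩
      len base + 2           ≤⟨ +-monoʳ-≤ (len base) (s≤s (s≤s z≤n)) ⟩
      len base + suc (suc t) ≡⟨ len-base ⟩
      len W                  ∎))
      where open ≤-Reasoning

    ad-aligned : ∀ a → AD E (x , a) (y , σ · a) (+ d)
    ad-aligned a = AD-positive (lift loopless P a eq) (len-lift loopless P a eq) len-E-walk≥d (sign-lift loopless P a eq)
      where
      eq : σ · a ≡ sign P · a
      eq = cong (_· a) (sym sign-P)

    ad-crossed-antipodal-value : IsDist G x y ⌊ g /2⌋ → + g ℤ.- + d ≡ + ⌈ g /2⌉
    ad-crossed-antipodal-value antipodal =
      trans (cong₂ (λ m n → + m ℤ.- + n) (sym (⌊n/2⌋+⌈n/2⌉≡n g)) (antipodal-distance antipodal))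
            (identity (+ ⌊ g /2⌋) (+ ⌈ g /2⌉))
      where
      identity : ∀ m n → m ℤ.+ n ℤ.- m ≡ n
      identity = solve-∀

    ad-crossed-antipodal : IsDist G x y ⌊ g /2⌋ → ∀ a → AD E (x , a) (y , neg · (σ · a)) (+ g ℤ.- + d)
    ad-crossed-antipodal antipodal a with antiparallel-walk
    ... | O , sign-O , len-O =
      subst (AD E (x , a) (y , neg · (σ · a))) (sym (ad-crossed-antipodal-value antipodal))
        (AD-positive (lift loopless O a eq) (trans (len-lift loopless O a eq) len-O≡⌈g/2⌉) lower
          (sign-lift loopless O a eq))
      where
      eq : neg · (σ · a) ≡ sign O · a
      eq = trans (sym (·-assoc neg σ a)) (cong (_· a) (sym sign-O))
      d≡⌊g/2⌋ = antipodal-distance antipodal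
      g≡⌈g/2⌉+d : g ≡ ⌈ g /2⌉ + d
      g≡⌈g/2⌉+d = trans (sym (⌊n/2⌋+⌈n/2⌉≡n g)) (trans (+-comm ⌊ g /2⌋ ⌈ g /2⌉) (cong (_+_ ⌈ g /2⌉) (sym d≡⌊g/2⌋)))
      len-O≡⌈g/2⌉ : len O ≡ ⌈ g /2⌉
      len-O≡⌈g/2⌉ = +-cancelʳ-≡ d (len O) ⌈ g /2⌉ (trans len-O g≡⌈g/2⌉+d)
      ⌈g/2⌉≤1+d : ⌈ g /2⌉ ≤ suc d
      ⌈g/2⌉≤1+d = subst (λ n → ⌈ g /2⌉ ≤ suc n) (sym d≡⌊g/2⌋) (⌈n/2⌉≤1+⌊n/2⌋ g)
      lower : ∀ (W : Walk E (x , a) (y , neg · (σ · a))) → ⌈ g /2⌉ ≤ len W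
      lower W with crossed-walk-length W
      ... | inj₁ g≤W+d = +-cancelʳ-≤ d ⌈ g /2⌉ (len W) (subst (_≤ len W + d) g≡⌈g/2⌉+d g≤W+d)
      ... | inj₂ (inj₁ (_ , 1+d≤W)) = ≤-trans ⌈g/2⌉≤1+d 1+d≤W
      ... | inj₂ (inj₂ 2+d≤W) = ≤-trans ⌈g/2⌉≤1+d (≤-trans (n≤1+n (suc d)) 2+d≤W)

    ad-crossed-non-antipodal : ¬ IsDist G x y ⌊ g /2⌋ → ∀ a → AD E (x , a) (y , neg · (σ · a)) (- (+ d) ℤ.- + 1)
    ad-crossed-non-antipodal not-antipodal a =
      subst (AD E (x , a) (y , neg · (σ · a))) (sym (-m-1≡-[1+m] d)) (AD-negative W len-W lower no-positive)
      where
      eq : σ · a ≡ sign P · a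
      eq = cong (_· a) (sym sign-P)
      W : Walk E (x , a) (y , neg · (σ · a))
      W = lift loopless P a eq ++ cons (y , neg · (σ · a)) neg (vertical-edge y (σ · a)) nil
      len-W : len W ≡ suc d
      len-W = trans (len-++ (lift loopless P a eq) _)
                (trans (+-comm (len (lift loopless P a eq)) 1) (cong suc (len-lift loopless P a eq)))
      far = non-antipodal-distance not-antipodal
      lower : ∀ (W′ : Walk E (x , a) (y , neg · (σ · a))) → suc d ≤ len W′
      lower W′ with crossed-walk-length W′
      ... | inj₁ g≤W′+d = ≤-trans (n≤1+n (suc d)) (+-cancelʳ-≤ d (suc (suc d)) (len W′) (≤-trans far g≤W′+d))
      ... | inj₂ (inj₁ (_ , 1+d≤W′)) = 1+d≤W′
      ... | inj₂ (inj₂ 2+d≤W′) = ≤-trans (n≤1+n (suc d)) 2+d≤W′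
      no-positive : ∀ (W′ : Walk E (x , a) (y , neg · (σ · a))) → sign W′ ≡ pos → len W′ ≢ suc d
      no-positive W′ positive W′≡1+d with crossed-walk-length W′
      ... | inj₁ g≤W′+d = <-irrefl refl (≤-trans far (subst (λ n → g ≤ n + d) W′≡1+d g≤W′+d))
      ... | inj₂ (inj₁ (negative , _)) with trans (sym positive) negative
      ...   | ()
      no-positive W′ positive W′≡1+d | inj₂ (inj₂ 2+d≤W′) = <-irrefl refl (subst (suc (suc d) ≤_) W′≡1+d 2+d≤W′)

open import Data.Fin.Properties using (_≟_)
open import Data.Integer using (_+_; _-_; _<_)

proposition2 : (n : ℕ) (G : SGraph (Fin n)) → Simple G → (g : ℕ) → Wide g G →
    (x y : Fin n) → OnCommonNegCycle G g x y → (p : ℤ) → AD G x y p →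
      ((+ 0 < p →
         AD (EDC _≟_ G) (x , pos) (y , pos) p × AD (EDC _≟_ G) (x , neg) (y , neg) p
         × (IsDist G x y ⌊ g /2⌋ →
              AD (EDC _≟_ G) (x , pos) (y , neg) (+ g - p)
              × AD (EDC _≟_ G) (x , neg) (y , pos) (+ g - p)
              × + g - p ≡ + ⌈ g /2⌉)
         × (¬ IsDist G x y ⌊ g /2⌋ →
              AD (EDC _≟_ G) (x , pos) (y , neg) (- p - + 1)
              × AD (EDC _≟_ G) (x , neg) (y , pos) (- p - + 1)))
      × (p < + 0 →
         AD (EDC _≟_ G) (x , pos) (y , neg) (- p) × AD (EDC _≟_ G) (x , neg) (y , pos) (- p)
         × (IsDist G x y ⌊ g /2⌋ →
              AD (EDC _≟_ G) (x , pos) (y , pos) (+ g + p)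
              × AD (EDC _≟_ G) (x , neg) (y , neg) (+ g + p)
              × + g + p ≡ + ⌈ g /2⌉)
         × (¬ IsDist G x y ⌊ g /2⌋ →
              AD (EDC _≟_ G) (x , pos) (y , pos) (p - + 1)
              × AD (EDC _≟_ G) (x , neg) (y , neg) (p - + 1))))
proposition2 n G simple g wide x y cycle _ (_ , (_ , shortest) , inj₁ ((P , _ , sign-P , refl) , refl)) =
  (λ _ → ad-aligned pos , ad-aligned neg ,
     (λ antipodal → ad-crossed-antipodal antipodal pos , ad-crossed-antipodal antipodal neg ,
                    ad-crossed-antipodal-value antipodal) ,
     (λ not-antipodal → ad-crossed-non-antipodal not-antipodal pos , ad-crossed-non-antipodal not-antipodal neg)) ,
  λ { (+<+ ()) }
  where open ShortestPathOnNegativeCycle _≟_ simple wide cycle P shortest sign-P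
proposition2 n G simple g wide x y cycle _ (_ , ((P , refl) , shortest) , inj₂ (no-positive-path , refl)) =
  (λ 0<-d → ⊥-elim (<⇒≱ 0<-d neg-≤-pos)) ,
  (λ _ → subst (AD E (x , pos) (y , neg)) (sym (neg-involutive _)) (ad-aligned pos) ,
         subst (AD E (x , neg) (y , pos)) (sym (neg-involutive _)) (ad-aligned neg) ,
     (λ antipodal → ad-crossed-antipodal antipodal pos , ad-crossed-antipodal antipodal neg ,
                    ad-crossed-antipodal-value antipodal) ,
     (λ not-antipodal → ad-crossed-non-antipodal not-antipodal pos , ad-crossed-non-antipodal not-antipodal neg))
  where
  sign-P : sign P ≡ neg
  sign-P = ¬PosPathOfLen⇒negative P shortest no-positive-path
  open ShortestPathOnNegativeCycle _≟_ simple wide cycle P shortest sign-P
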